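{- Let $G=(V,E)$ be a graph with a unique hamiltonian path $P_H$ from $s\in V$ to $t\in V$. Let $x\in V\setminus\{s,t\}$ have degree $3$ with neighbours $y,x_1,x_2$, and suppose the edge $\{x,y\}$ is not on $P_H$. Let $\mathcal{P}=(P,s',t',v)$ be an H-plugin. Suppose at least one of the following holds: (i) $y\notin\{s,t\}$ and $G[V\setminus\{y\}]$ has no hamiltonian path from $s$ to $t$; (ii) $\{x,y\}$ lies in a triangle of $G$; (iii) $\mathcal{P}$ is a strong H-plugin; (iv) $y\in\{s,t\}$. Then $O(x,y,\mathcal{P})$ (for either choice of which of the two neighbours of $x$ other than $y$ is called $x_1$) has a unique hamiltonian path $P_{H,O}$ from $s$ to $t$, and every edge of $P_H$ that is not incident with $x$ is contained in $P_{H,O}$.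
   Context: Graphs are finite, simple and undirected. For a graph $P=(V_P,E_P)$ and vertices $s',t',v$ of $P$, let $P_{ -v}=P[V_P\setminus\{v\}]$. $\mathcal{P}=(P,s',t',v)$ is an H-plugin (or weak H-plugin) if $P_{ -v}$ has a unique hamiltonian path from $s'$ to $t'$; it is a strong H-plugin if moreover $P$ has no hamiltonian path from $s'$ to $t'$. Splicing: for an H-plugin $\mathcal{P}=(P,s',t',v)$ and a graph $G$ with a vertex $x$ of degree $3$ with neighbours $y,x_1,x_2$, the $\mathcal{P}$-splice $O(x,y,\mathcal{P})$ is obtained by taking a copy of $P$ disjoint from $G$, deleting $x$ from $G$, adding an edge between $x_1$ and the copy of $s'$ and an edge between $x_2$ and the copy of $t'$, and identifying the copy of $v$ with $y$. -}

module Defs where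

open import Level using (0ℓ)
open import Data.Bool using (Bool; true; false; not; T)
open import Data.Unit using (tt)
open import Data.Empty using (⊥; ⊥-elim)
open import Data.Maybe using (Maybe; just; nothing)
open import Data.Product using (Σ; ∃; ∃-syntax; _×_; _,_; proj₁; proj₂)
open import Data.Sum using (_⊎_; inj₁; inj₂)
open import Data.List using (List; []; _∷_; head; last; _++_; map)
open import Data.List.Membership.Propositional using (_∈_)
open import Data.List.Relation.Unary.Any using (here; there)
open import Data.List.Relation.Unary.Unique.Propositional using (Unique)
open import Data.List.Relation.Unary.Linked using (Linked)
open import Relation.Nullary using (¬_; Dec; yes; no)
open import Relation.Nullary.Decidable using (⌊_⌋)
open import Relation.Binary using (DecidableEquality)
open import Relation.Nullary.Decidable using (_×-dec_; _⊎-dec_)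
import Relation.Nullary.Decidable as Dec
open import Data.Sum.Properties using (≡-dec)
open import Data.List.Membership.Propositional.Properties using (∈-++⁺ˡ; ∈-++⁺ʳ; ∈-map⁺)
open import Function using (_|>_)
open import Relation.Binary.PropositionalEquality using (_≡_; refl; _≢_; subst; cong; sym)

record Graph : Set₁ where
  field
    V        : Set
    _≟_      : DecidableEquality V
    vertices : List V
    complete : ∀ u → u ∈ vertices
    E        : V → V → Set
    E?       : ∀ u w → Dec (E u w)
    E-sym    : ∀ {u w} → E u w → E w u
    E-irrefl : ∀ {u} → ¬ E u u

open Graph public

IsHamPath : (G : Graph) → V G → V G → List (V G) → Set
IsHamPath G s t p =
  Unique p × (∀ u → u ∈ p) × Linked (E G) p × head p ≡ just s × last p ≡ just t

HasHamPath : (G : Graph) → V G → V G → Set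
HasHamPath G s t = ∃[ p ] IsHamPath G s t p

UniqueHamPath : (G : Graph) → V G → V G → Set
UniqueHamPath G s t =
  ∃[ p ] (IsHamPath G s t p × (∀ q → IsHamPath G s t q → q ≡ p))

data EdgeIn {A : Set} (a b : A) : List A → Set where
  here₁ : ∀ {rest} → EdgeIn a b (a ∷ b ∷ rest)
  here₂ : ∀ {rest} → EdgeIn a b (b ∷ a ∷ rest)
  there : ∀ {u rest} → EdgeIn a b rest → EdgeIn a b (u ∷ rest)

T-irrel : ∀ b (p q : T b) → p ≡ q
T-irrel true  tt tt = refl

Sub : {A : Set} → (A → Bool) → Set
Sub {A} k = Σ A (λ a → T (k a))

Sub-≟ : {A : Set} (k : A → Bool) → DecidableEquality A → DecidableEquality (Sub k)
Sub-≟ k _≟A_ (a , p) (b , q) with a ≟A b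
... | no a≢b = no λ { refl → a≢b refl }
... | yes refl with T-irrel (k a) p q
... | refl = yes refl

module _ {A : Set} (k : A → Bool) where

  restrictStep : (a : A) (b : Bool) → k a ≡ b → List (Sub k) → List (Sub k)
  restrictStep a true  eq rest = (a , subst T (sym eq) tt) ∷ rest
  restrictStep a false eq rest = rest

  restrictList : List A → List (Sub k)
  restrictList []       = []
  restrictList (a ∷ as) = restrictStep a (k a) refl (restrictList as)

  restrictStep-here : (a : A) (b : Bool) (eq : k a ≡ b) (rest : List (Sub k))
                      (px : T (k a)) → (a , px) ∈ restrictStep a b eq rest
  restrictStep-here a true  eq rest px = here (cong (a ,_) (T-irrel (k a) px _))
  restrictStep-here a false eq rest px = ⊥-elim (subst T eq px)

  restrictStep-there : (a : A) (b : Bool) (eq : k a ≡ b) (rest : List (Sub k))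
                       (y : Sub k) → y ∈ rest → y ∈ restrictStep a b eq rest
  restrictStep-there a true  eq rest y m = there m
  restrictStep-there a false eq rest y m = m

  restrictList-∈ : (as : List A) (x : Sub k) → proj₁ x ∈ as → x ∈ restrictList as
  restrictList-∈ (a ∷ as) (x , px) (here refl) =
    restrictStep-here a (k a) refl (restrictList as) px
  restrictList-∈ (a ∷ as) x (there m) =
    restrictStep-there a (k a) refl (restrictList as) x (restrictList-∈ as x m)

_-ᵛ_ : (G : Graph) → V G → Graph
G -ᵛ v = record
  { V        = Sub k
  ; _≟_      = Sub-≟ k (_≟_ G)
  ; vertices = restrictList k (vertices G)
  ; complete = λ u → restrictList-∈ k (vertices G) u (complete G (proj₁ u))
  ; E        = λ a b → E G (proj₁ a) (proj₁ b)
  ; E?       = λ a b → E? G (proj₁ a) (proj₁ b)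
  ; E-sym    = E-sym G
  ; E-irrefl = E-irrefl G
  }
  where
  k : V G → Bool
  k u = not ⌊ _≟_ G u v ⌋

UniqueHamPathAvoiding : (G : Graph) (v s t : V G) → Set
UniqueHamPathAvoiding G v s t =
  ∃[ s₀ ] ∃[ t₀ ] (proj₁ {B = λ _ → _} s₀ ≡ s × proj₁ {B = λ _ → _} t₀ ≡ t
                  × UniqueHamPath (G -ᵛ v) s₀ t₀)

HasHamPathAvoiding : (G : Graph) (v s t : V G) → Set
HasHamPathAvoiding G v s t =
  ∃[ s₀ ] ∃[ t₀ ] (proj₁ {B = λ _ → _} s₀ ≡ s × proj₁ {B = λ _ → _} t₀ ≡ t
                  × HasHamPath (G -ᵛ v) s₀ t₀)

IsHPlugin : (P : Graph) (s' t' v : V P) → Set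
IsHPlugin P s' t' v = UniqueHamPathAvoiding P v s' t'

IsStrongHPlugin : (P : Graph) (s' t' v : V P) → Set
IsStrongHPlugin P s' t' v = IsHPlugin P s' t' v × ¬ HasHamPath P s' t'

Degree3With : (G : Graph) (x y x₁ x₂ : V G) → Set
Degree3With G x y x₁ x₂ =
  E G x y × E G x x₁ × E G x x₂ × y ≢ x₁ × y ≢ x₂ × x₁ ≢ x₂
  × (∀ w → E G x w → w ≡ y ⊎ w ≡ x₁ ⊎ w ≡ x₂)

-- The splice O(x, y, 𝒫).
-- Vertices: (V_G ∖ {x}) ⊎ (V_P ∖ {v}); the copy of v is identified with y,
-- so every edge {v, p} of P becomes an edge {y, p}; further edges
-- {x₁, s'} and {x₂, t'}.

module _ (G : Graph) (x y x₁ x₂ : V G) (P : Graph) (s' t' v : V P) where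

  spliceKeep : V G ⊎ V P → Bool
  spliceKeep (inj₁ u) = not ⌊ _≟_ G u x ⌋
  spliceKeep (inj₂ p) = not ⌊ _≟_ P p v ⌋

  Cross : V G → V P → Set
  Cross a b = (a ≡ y × E P v b) ⊎ (a ≡ x₁ × b ≡ s') ⊎ (a ≡ x₂ × b ≡ t')

  Cross? : ∀ a b → Dec (Cross a b)
  Cross? a b =
    ((_≟_ G a y ×-dec E? P v b) ⊎-dec (_≟_ G a x₁ ×-dec _≟_ P b s'))
      ⊎-dec (_≟_ G a x₂ ×-dec _≟_ P b t')
    |> λ d → Dec.map′ reassoc unassoc d
    where
    reassoc : ∀ {A B C : Set} → (A ⊎ B) ⊎ C → A ⊎ B ⊎ C
    reassoc (inj₁ (inj₁ a)) = inj₁ a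
    reassoc (inj₁ (inj₂ b)) = inj₂ (inj₁ b)
    reassoc (inj₂ c)        = inj₂ (inj₂ c)
    unassoc : ∀ {A B C : Set} → A ⊎ B ⊎ C → (A ⊎ B) ⊎ C
    unassoc (inj₁ a)        = inj₁ (inj₁ a)
    unassoc (inj₂ (inj₁ b)) = inj₁ (inj₂ b)
    unassoc (inj₂ (inj₂ c)) = inj₂ c

  SE : V G ⊎ V P → V G ⊎ V P → Set
  SE (inj₁ a) (inj₁ b) = E G a b
  SE (inj₂ a) (inj₂ b) = E P a b
  SE (inj₁ a) (inj₂ b) = Cross a b
  SE (inj₂ b) (inj₁ a) = Cross a b

  SE? : ∀ a b → Dec (SE a b)
  SE? (inj₁ a) (inj₁ b) = E? G a b
  SE? (inj₂ a) (inj₂ b) = E? P a b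
  SE? (inj₁ a) (inj₂ b) = Cross? a b
  SE? (inj₂ b) (inj₁ a) = Cross? a b

  SE-sym : ∀ {a b} → SE a b → SE b a
  SE-sym {inj₁ a} {inj₁ b} e = E-sym G e
  SE-sym {inj₂ a} {inj₂ b} e = E-sym P e
  SE-sym {inj₁ a} {inj₂ b} e = e
  SE-sym {inj₂ b} {inj₁ a} e = e

  SE-irrefl : ∀ {a} → ¬ SE a a
  SE-irrefl {inj₁ a} = E-irrefl G
  SE-irrefl {inj₂ a} = E-irrefl P

  splice : Graph
  splice = record
    { V        = Sub spliceKeep
    ; _≟_      = Sub-≟ spliceKeep (≡-dec (_≟_ G) (_≟_ P))
    ; vertices = restrictList spliceKeep all
    ; complete = λ u → restrictList-∈ spliceKeep all u (all-complete (proj₁ u))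
    ; E        = λ a b → SE (proj₁ a) (proj₁ b)
    ; E?       = λ a b → SE? (proj₁ a) (proj₁ b)
    ; E-sym    = λ {a} {b} → SE-sym {proj₁ a} {proj₁ b}
    ; E-irrefl = λ {a} → SE-irrefl {proj₁ a}
    }
    where
    all : List (V G ⊎ V P)
    all = map inj₁ (vertices G) ++ map inj₂ (vertices P)
    all-complete : ∀ u → u ∈ all
    all-complete (inj₁ a) = ∈-++⁺ˡ (∈-map⁺ inj₁ (complete G a))
    all-complete (inj₂ b) = ∈-++⁺ʳ (map inj₁ (vertices G)) (∈-map⁺ inj₂ (complete P b))

module Submission where

-- A hamiltonian s–t path of the splice O crosses between G − x and P − v only along the edges
-- y–N_P(v), x₁–s′ and x₂–t′, so it alternates between runs in G and runs in P, beginning and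
-- ending in G. The ends of a G-run that meets P are among the three ports y, x₁, x₂, and only y
-- has more than one plugin neighbour; so a G-run strictly between two P-runs is the single vertex
-- y, and at most two P-runs occur. With one P-run, replacing it by x gives a hamiltonian path of G,
-- which must be P_H, and the run is then a hamiltonian s′–t′ path of P − v (in one direction or
-- the other), hence the unique one: the path is P_H with x replaced by the plugin path. With two
-- P-runs, y is an inner vertex; replacing y by x gives a hamiltonian s–t path of G − y, a common
-- neighbour z of x and y reroutes P_H through the edge xy, and the two P-runs joined through v
-- form a hamiltonian path of P between s′ and t′: each contradicts one of the conditions (i)–(iv).

open import Defs
open import Data.List using (List)
open import Data.Product using (Σ; ∃; ∃-syntax; _×_; _,_; proj₁)
open import Data.Sum using (_⊎_; inj₁; inj₂)
open import Relation.Nullary using (¬_)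
open import Relation.Binary.PropositionalEquality using (_≡_; _≢_)

open import Data.Bool using (Bool; T; not)
open import Data.Empty using (⊥; ⊥-elim)
open import Data.Maybe using (just)
import Data.Maybe as Maybe
import Data.Maybe.Properties as Maybe
import Data.Maybe.Relation.Binary.Connected as Connected
open import Data.Product using (proj₂; swap)
open import Data.Sum using ([_,_]′; isInj₁; isInj₂) renaming (map to ⊎-map; swap to ⊎-swap)
import Data.Sum.Properties as Sum
open import Data.Unit using (tt)
open import Data.List using ([]; _∷_; [_]; _++_; head; last; map; mapMaybe; reverse)
open import Data.List.Properties
  using (∷-injective; ++-assoc; ++-identityʳ; head-map; last-map; map-injective;
         mapMaybeIsInj₁∘mapInj₁; mapMaybeIsInj₂∘mapInj₁; reverse-involutive; unfold-reverse)
open import Data.List.Membership.Propositional using (_∈_; _∉_)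
open import Data.List.Membership.Propositional.Properties
  using (∈-++⁺ˡ; ∈-++⁺ʳ; ∈-++⁻; ∈-insert; ∈-map⁺; ∈-map⁻; ∈-∃++)
import Data.List.Relation.Binary.Permutation.Setoid as Permutation
import Data.List.Relation.Binary.Permutation.Setoid.Properties as PermutationProperties
open import Data.List.Relation.Unary.All as All using ([]; _∷_)
import Data.List.Relation.Unary.All.Properties as All
open import Data.List.Relation.Unary.AllPairs using ([]; _∷_)
open import Data.List.Relation.Unary.Any using (here; there)
import Data.List.Relation.Unary.Any.Properties as Any
open import Data.List.Relation.Unary.Linked using (Linked; []; [-]; _∷_)
import Data.List.Relation.Unary.Linked as Linked
import Data.List.Relation.Unary.Linked.Properties as Linked
open import Data.List.Relation.Unary.Unique.Propositional using (Unique)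
import Data.List.Relation.Unary.Unique.Propositional.Properties as Unique
open import Function using (id; _∘_; _∘′_; _on_)
open import Relation.Binary using (DecidableEquality)
open import Relation.Binary.PropositionalEquality using (refl; sym; trans; cong; subst; subst₂; setoid)
open import Relation.Nullary using (Dec; yes; no)
open import Relation.Nullary.Decidable using (⌊_⌋; fromWitnessFalse; toWitnessFalse)
open import Relation.Unary using (U; _⟨⊎⟩_)

variable
  A B : Set

lastOf : A → List A → A
lastOf a []       = a
lastOf _ (b ∷ bs) = lastOf b bs

last-∷ : (a : A) (as : List A) → last (a ∷ as) ≡ just (lastOf a as)
last-∷ a []       = refl
last-∷ a (b ∷ bs) = last-∷ b bs

last-++-∷ : (xs : List A) (b : A) (bs : List A) → last (xs ++ b ∷ bs) ≡ just (lastOf b bs)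
last-++-∷ []       b bs = last-∷ b bs
last-++-∷ (x ∷ xs) b bs = trans (last-∷ x (xs ++ b ∷ bs)) (cong just (lastOf-++ x xs))
  where
  lastOf-++ : ∀ a as → lastOf a (as ++ b ∷ bs) ≡ lastOf b bs
  lastOf-++ a []       = refl
  lastOf-++ a (c ∷ cs) = lastOf-++ c cs

last-++ʳ : (xs : List A) {y : A} {ys : List A} → last (xs ++ y ∷ ys) ≡ last (y ∷ ys)
last-++ʳ xs {y} {ys} = trans (last-++-∷ xs y ys) (sym (last-∷ y ys))

lastOf-∈ : (a : A) (as : List A) → lastOf a as ∈ a ∷ as
lastOf-∈ a []       = here refl
lastOf-∈ a (b ∷ bs) = there (lastOf-∈ b bs)

lastOf-map : (f : A → B) (a : A) (as : List A) → lastOf (f a) (map f as) ≡ f (lastOf a as)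
lastOf-map f a []       = refl
lastOf-map f a (b ∷ bs) = lastOf-map f b bs

last-map-∷ : (f : A → B) (a : A) (as : List A) → last (map f (a ∷ as)) ≡ just (f (lastOf a as))
last-map-∷ f a as = trans (last-∷ (f a) (map f as)) (cong just (lastOf-map f a as))

head-∈ : {a : A} (l : List A) → head l ≡ just a → a ∈ l
head-∈ (x ∷ l) refl = here refl

last-∈ : {a : A} (l : List A) → last l ≡ just a → a ∈ l
last-∈ (x ∷ l) eq =
  subst (_∈ x ∷ l) (Maybe.just-injective (trans (sym (last-∷ x l)) eq)) (lastOf-∈ x l)

last-reverse : (l : List A) → last (reverse l) ≡ head l
last-reverse []       = refl
last-reverse (x ∷ xs) = trans (cong last (unfold-reverse x xs)) (last-++-∷ (reverse xs) x [])

head-reverse : (l : List A) → head (reverse l) ≡ last l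
head-reverse l = trans (sym (last-reverse (reverse l))) (cong last (reverse-involutive l))

module _ {R : A → A → Set} where

  Linked-++⁻ˡ : ∀ xs {ys} → Linked R (xs ++ ys) → Linked R xs
  Linked-++⁻ˡ []           _        = []
  Linked-++⁻ˡ (x ∷ [])     _        = [-]
  Linked-++⁻ˡ (x ∷ y ∷ xs) (r ∷ rs) = r ∷ Linked-++⁻ˡ (y ∷ xs) rs

  Linked-++⁻ʳ : ∀ xs {ys} → Linked R (xs ++ ys) → Linked R ys
  Linked-++⁻ʳ []       rs = rs
  Linked-++⁻ʳ (x ∷ xs) rs = Linked-++⁻ʳ xs (Linked.tail rs)

  Linked-boundary : ∀ a as {b bs} → Linked R ((a ∷ as) ++ b ∷ bs) → R (lastOf a as) b
  Linked-boundary a []       (r ∷ _)  = r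
  Linked-boundary a (c ∷ cs) (_ ∷ rs) = Linked-boundary c cs rs

  Linked-join : ∀ {a as b bs} →
                Linked R (a ∷ as) → R (lastOf a as) b → Linked R (b ∷ bs) →
                Linked R ((a ∷ as) ++ b ∷ bs)
  Linked-join [-]      r rs = r ∷ rs
  Linked-join (r ∷ rs) r′ rs′ = r ∷ Linked-join rs r′ rs′

module _ {R : A → A → Set} (f : B → A) where

  Linked-run⁻ : ∀ {a as b bs} → Linked R (map f (a ∷ as) ++ b ∷ bs) → Linked (R on f) (a ∷ as)
  Linked-run⁻ {a} {as} lk = Linked.map⁻ (Linked-++⁻ˡ (map f (a ∷ as)) lk)

  Linked-run-exit : ∀ {a as b bs} → Linked R (map f (a ∷ as) ++ b ∷ bs) → R (f (lastOf a as)) b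
  Linked-run-exit {a} {as} lk =
    subst (λ u → R u _) (lastOf-map f a as) (Linked-boundary (f a) (map f as) lk)

  Linked-run-rest : ∀ {a as b bs} → Linked R (map f (a ∷ as) ++ b ∷ bs) → Linked R (b ∷ bs)
  Linked-run-rest {a} {as} = Linked-++⁻ʳ (map f (a ∷ as))

  Linked-map-join : ∀ {a as b bs} → Linked (R on f) (a ∷ as) → R (f (lastOf a as)) b →
                    Linked R (b ∷ bs) → Linked R (map f (a ∷ as) ++ b ∷ bs)
  Linked-map-join {a} {as} lk r lk′ =
    Linked-join (Linked.map⁺ lk) (subst (λ u → R u _) (sym (lastOf-map f a as)) r) lk′

Linked-reverse : {R : A → A → Set} → (∀ {a b} → R a b → R b a) →
                 ∀ {l} → Linked R l → Linked R (reverse l)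
Linked-reverse R-sym []  = []
Linked-reverse R-sym [-] = [-]
Linked-reverse {R = R} R-sym {x ∷ y ∷ ys} (r ∷ rs) =
  subst (Linked R) (sym (unfold-reverse x (y ∷ ys)))
    (Linked.++⁺ (Linked-reverse R-sym rs)
      (subst (λ m → Connected.Connected R m (just x)) (sym (last-reverse (y ∷ ys)))
             (Connected.just (R-sym r)))
      [-])

Unique-++-disjoint : ∀ (xs : List A) {ys a b} → Unique (xs ++ ys) → a ∈ xs → b ∈ ys → a ≢ b
Unique-++-disjoint (x ∷ xs) (x∉ ∷ _) (here refl) b∈ = All.lookup (All.++⁻ʳ xs x∉) b∈
Unique-++-disjoint (x ∷ xs) (_ ∷ u)  (there a∈)  b∈ = Unique-++-disjoint xs u a∈ b∈

Unique-++⁻ʳ : ∀ (xs : List A) {ys} → Unique (xs ++ ys) → Unique ys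
Unique-++⁻ʳ []       u       = u
Unique-++⁻ʳ (x ∷ xs) (_ ∷ u) = Unique-++⁻ʳ xs u

Unique-++⁻ˡ : ∀ (xs : List A) {ys} → Unique (xs ++ ys) → Unique xs
Unique-++⁻ˡ []       _        = []
Unique-++⁻ˡ (x ∷ xs) (x∉ ∷ u) = All.++⁻ˡ xs x∉ ∷ Unique-++⁻ˡ xs u

Unique-insert : ∀ (xs : List A) {ys z} → Unique (xs ++ ys) → z ∉ xs ++ ys → Unique (xs ++ z ∷ ys)
Unique-insert []       u        z∉ = All.tabulate (λ b∈ z≡b → z∉ (subst (_∈ _) (sym z≡b) b∈)) ∷ u
Unique-insert (x ∷ xs) (x∉ ∷ u) z∉ =
  All.++⁺ (All.++⁻ˡ xs x∉) ((λ x≡z → z∉ (here (sym x≡z))) ∷ All.++⁻ʳ xs x∉)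
  ∷ Unique-insert xs u (λ z∈ → z∉ (there z∈))

Unique-delete : ∀ (xs : List A) {ys z} → Unique (xs ++ z ∷ ys) → Unique (xs ++ ys)
Unique-delete []       (_ ∷ u)  = u
Unique-delete (x ∷ xs) (x∉ ∷ u) with All.++⁻ xs x∉
... | x∉xs , _ ∷ x∉ys = All.++⁺ x∉xs x∉ys ∷ Unique-delete xs u

Unique-lastOf : ∀ {a : A} as → Unique (a ∷ as) → lastOf a as ≡ a → as ≡ []
Unique-lastOf []       _          _  = refl
Unique-lastOf (b ∷ bs) (a∉ ∷ _) eq = ⊥-elim (All.lookup a∉ (lastOf-∈ b bs) (sym eq))

∈-++-insert : ∀ (xs : List A) {ys u z} → u ∈ xs ++ ys → u ∈ xs ++ z ∷ ys
∈-++-insert xs u∈ with ∈-++⁻ xs u∈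
... | inj₁ u∈xs = ∈-++⁺ˡ u∈xs
... | inj₂ u∈ys = ∈-++⁺ʳ xs (there u∈ys)

∈-++-delete : ∀ (xs : List A) {ys u z} → u ∈ xs ++ z ∷ ys → u ≢ z → u ∈ xs ++ ys
∈-++-delete xs u∈ u≢z with ∈-++⁻ xs u∈
... | inj₁ u∈xs         = ∈-++⁺ˡ u∈xs
... | inj₂ (here u≡z)   = ⊥-elim (u≢z u≡z)
... | inj₂ (there u∈ys) = ∈-++⁺ʳ xs u∈ys

∉-++-middle : ∀ (xs : List A) {ys u z} → Unique (xs ++ z ∷ ys) → u ∈ xs ++ ys → u ≢ z
∉-++-middle xs {ys} u u∈ with ∈-++⁻ xs u∈
... | inj₁ u∈xs = Unique-++-disjoint xs u u∈xs (here refl)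
... | inj₂ u∈ys = λ u≡z → Unique-++-disjoint [ _ ] (Unique-++⁻ʳ xs u) (here refl) u∈ys (sym u≡z)

++-cancel-middle : ∀ {z : A} (xs ys xs′ ys′ : List A) → z ∉ xs → z ∉ xs′ →
                   xs ++ z ∷ ys ≡ xs′ ++ z ∷ ys′ → xs ≡ xs′ × ys ≡ ys′
++-cancel-middle []       ys []         ys′ _  _   refl = refl , refl
++-cancel-middle []       ys (x′ ∷ xs′) ys′ _  z∉′ eq   = ⊥-elim (z∉′ (here (proj₁ (∷-injective eq))))
++-cancel-middle (x ∷ xs) ys []         ys′ z∉ _   eq   = ⊥-elim (z∉ (here (sym (proj₁ (∷-injective eq)))))
++-cancel-middle (x ∷ xs) ys (x′ ∷ xs′) ys′ z∉ z∉′ eq with ∷-injective eq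
... | refl , eq′ with ++-cancel-middle xs ys xs′ ys′ (λ z∈ → z∉ (there z∈)) (λ z∈ → z∉′ (there z∈)) eq′
...   | refl , refl = refl , refl

split-at-interior : ∀ {l : List A} {s t x} → x ∈ l → head l ≡ just s → last l ≡ just t → x ≢ s → x ≢ t →
                    ∃[ a₀ ] ∃[ as ] ∃[ b₀ ] ∃[ bs ] l ≡ (a₀ ∷ as) ++ x ∷ b₀ ∷ bs
split-at-interior {x = x} x∈ hd lt x≢s x≢t with ∈-∃++ x∈
... | [] , _ , refl = ⊥-elim (x≢s (Maybe.just-injective hd))
... | a₀ ∷ as , [] , refl = ⊥-elim (x≢t (Maybe.just-injective (trans (sym (last-++-∷ (a₀ ∷ as) x [])) lt)))
... | a₀ ∷ as , b₀ ∷ bs , refl = a₀ , as , b₀ , bs , refl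

EdgeIn-sym : {a b : A} {l : List A} → EdgeIn a b l → EdgeIn b a l
EdgeIn-sym here₁     = here₂
EdgeIn-sym here₂     = here₁
EdgeIn-sym (there e) = there (EdgeIn-sym e)

EdgeIn-++⁺ˡ : {a b : A} {xs : List A} (ys : List A) → EdgeIn a b xs → EdgeIn a b (xs ++ ys)
EdgeIn-++⁺ˡ ys here₁     = here₁
EdgeIn-++⁺ˡ ys here₂     = here₂
EdgeIn-++⁺ˡ ys (there e) = there (EdgeIn-++⁺ˡ ys e)

EdgeIn-++⁺ʳ : {a b : A} (xs : List A) {ys : List A} → EdgeIn a b ys → EdgeIn a b (xs ++ ys)
EdgeIn-++⁺ʳ []       e = e
EdgeIn-++⁺ʳ (x ∷ xs) e = there (EdgeIn-++⁺ʳ xs e)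

EdgeIn-map⁺ : {a b : A} (f : A → B) {xs : List A} → EdgeIn a b xs → EdgeIn (f a) (f b) (map f xs)
EdgeIn-map⁺ f here₁     = here₁
EdgeIn-map⁺ f here₂     = here₂
EdgeIn-map⁺ f (there e) = there (EdgeIn-map⁺ f e)

EdgeIn-∷∷⁻ : {a b c d : A} {l : List A} → EdgeIn a b (c ∷ d ∷ l) →
             (a ≡ c × b ≡ d) ⊎ (b ≡ c × a ≡ d) ⊎ EdgeIn a b (d ∷ l)
EdgeIn-∷∷⁻ here₁     = inj₁ (refl , refl)
EdgeIn-∷∷⁻ here₂     = inj₂ (inj₁ (refl , refl))
EdgeIn-∷∷⁻ (there e) = inj₂ (inj₂ e)

EdgeIn-map⁻ : {f : A → B} → (∀ {a b} → f a ≡ f b → a ≡ b) →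
              ∀ {a b} xs → EdgeIn (f a) (f b) (map f xs) → EdgeIn a b xs
EdgeIn-map⁻ inj (c ∷ [])     (there ())
EdgeIn-map⁻ inj (c ∷ d ∷ xs) e =
  [ (λ (p , q) → subst₂ (λ a b → EdgeIn a b _) (sym (inj p)) (sym (inj q)) here₁)
  , [ (λ (p , q) → subst₂ (λ a b → EdgeIn a b _) (sym (inj q)) (sym (inj p)) here₂)
    , (λ e′ → there (EdgeIn-map⁻ inj (d ∷ xs) e′)) ]′ ]′ (EdgeIn-∷∷⁻ e)

EdgeIn-++-∷⁻ : {a b z : A} (xs : List A) {ys : List A} → a ≢ z → b ≢ z →
               EdgeIn a b (xs ++ z ∷ ys) → EdgeIn a b xs ⊎ EdgeIn a b ys
EdgeIn-++-∷⁻ []           a≢z b≢z here₁     = ⊥-elim (a≢z refl)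
EdgeIn-++-∷⁻ []           a≢z b≢z here₂     = ⊥-elim (b≢z refl)
EdgeIn-++-∷⁻ []           a≢z b≢z (there e) = inj₂ e
EdgeIn-++-∷⁻ (x ∷ [])     a≢z b≢z here₁     = ⊥-elim (b≢z refl)
EdgeIn-++-∷⁻ (x ∷ [])     a≢z b≢z here₂     = ⊥-elim (a≢z refl)
EdgeIn-++-∷⁻ (x ∷ y ∷ xs) a≢z b≢z here₁     = inj₁ here₁
EdgeIn-++-∷⁻ (x ∷ y ∷ xs) a≢z b≢z here₂     = inj₁ here₂
EdgeIn-++-∷⁻ (x ∷ xs)     a≢z b≢z (there e) with EdgeIn-++-∷⁻ xs a≢z b≢z e
... | inj₁ e′ = inj₁ (there e′)
... | inj₂ e′ = inj₂ e′

EdgeIn-lastOf : (a : A) (as : List A) (z : A) (zs : List A) → EdgeIn (lastOf a as) z ((a ∷ as) ++ z ∷ zs)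
EdgeIn-lastOf a []       z zs = here₁
EdgeIn-lastOf a (b ∷ bs) z zs = there (EdgeIn-lastOf b bs z zs)

EdgeIn-middle : (xs : List A) (a b : A) (ys : List A) → EdgeIn a b (xs ++ a ∷ b ∷ ys)
EdgeIn-middle []       a b ys = here₁
EdgeIn-middle (x ∷ xs) a b ys = there (EdgeIn-middle xs a b ys)

module _ {b c : A} where

  two-in-two : ∀ {p q} → p ≡ b ⊎ p ≡ c → q ≡ b ⊎ q ≡ c → p ≢ q → (p ≡ b × q ≡ c) ⊎ (p ≡ c × q ≡ b)
  two-in-two (inj₁ refl) (inj₁ refl) p≢q = ⊥-elim (p≢q refl)
  two-in-two (inj₁ p≡b)  (inj₂ q≡c)  _   = inj₁ (p≡b , q≡c)
  two-in-two (inj₂ p≡c)  (inj₁ q≡b)  _   = inj₂ (p≡c , q≡b)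
  two-in-two (inj₂ refl) (inj₂ refl) p≢q = ⊥-elim (p≢q refl)

  three-in-two : ∀ {p q r} → p ≡ b ⊎ p ≡ c → q ≡ b ⊎ q ≡ c → r ≡ b ⊎ r ≡ c →
                 p ≢ q → p ≢ r → q ≢ r → ⊥
  three-in-two (inj₁ refl) (inj₁ refl) _           p≢q _   _   = p≢q refl
  three-in-two (inj₂ refl) (inj₂ refl) _           p≢q _   _   = p≢q refl
  three-in-two (inj₁ refl) (inj₂ refl) (inj₁ refl) _   p≢r _   = p≢r refl
  three-in-two (inj₁ refl) (inj₂ refl) (inj₂ refl) _   _   q≢r = q≢r refl
  three-in-two (inj₂ refl) (inj₁ refl) (inj₁ refl) _   _   q≢r = q≢r refl
  three-in-two (inj₂ refl) (inj₁ refl) (inj₂ refl) _   p≢r _   = p≢r refl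

module _ {a b c : A} where

  drop-first : ∀ {w} → w ≡ a ⊎ w ≡ b ⊎ w ≡ c → a ≢ w → w ≡ b ⊎ w ≡ c
  drop-first (inj₁ refl) a≢w = ⊥-elim (a≢w refl)
  drop-first (inj₂ w∈)   _   = w∈

  four-in-three : ∀ {p q r s} →
                  p ≡ a ⊎ p ≡ b ⊎ p ≡ c → q ≡ a ⊎ q ≡ b ⊎ q ≡ c →
                  r ≡ a ⊎ r ≡ b ⊎ r ≡ c → s ≡ a ⊎ s ≡ b ⊎ s ≡ c →
                  p ≢ q → p ≢ r → p ≢ s → q ≢ r → q ≢ s → r ≢ s → ⊥
  four-in-three (inj₁ refl) q r s p≢q p≢r p≢s q≢r q≢s r≢s =
    three-in-two (drop-first q p≢q) (drop-first r p≢r) (drop-first s p≢s) q≢r q≢s r≢s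
  four-in-three (inj₂ p′) (inj₁ refl) r s p≢q p≢r p≢s q≢r q≢s r≢s =
    three-in-two p′ (drop-first r q≢r) (drop-first s q≢s) p≢r p≢s r≢s
  four-in-three (inj₂ p′) (inj₂ q′) (inj₁ refl) s p≢q p≢r p≢s q≢r q≢s r≢s =
    three-in-two p′ q′ (drop-first s r≢s) p≢q p≢s q≢s
  four-in-three (inj₂ p′) (inj₂ q′) (inj₂ r′) s p≢q p≢r p≢s q≢r q≢s r≢s =
    three-in-two p′ q′ r′ p≢q p≢r q≢r

lefts : List (A ⊎ B) → List A
lefts = mapMaybe isInj₁

rights : List (A ⊎ B) → List B
rights = mapMaybe isInj₂

lefts-inj₁-++ : (xs : List A) (l : List (A ⊎ B)) → lefts (map inj₁ xs ++ l) ≡ xs ++ lefts l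
lefts-inj₁-++ []       l = refl
lefts-inj₁-++ (x ∷ xs) l = cong (x ∷_) (lefts-inj₁-++ xs l)

lefts-inj₂-++ : (ys : List B) (l : List (A ⊎ B)) → lefts (map inj₂ ys ++ l) ≡ lefts l
lefts-inj₂-++ []       l = refl
lefts-inj₂-++ (y ∷ ys) l = lefts-inj₂-++ ys l

rights-inj₁-++ : (xs : List A) (l : List (A ⊎ B)) → rights (map inj₁ xs ++ l) ≡ rights l
rights-inj₁-++ []       l = refl
rights-inj₁-++ (x ∷ xs) l = rights-inj₁-++ xs l

rights-inj₂-++ : (ys : List B) (l : List (A ⊎ B)) → rights (map inj₂ ys ++ l) ≡ ys ++ rights l
rights-inj₂-++ []       l = refl
rights-inj₂-++ (y ∷ ys) l = cong (y ∷_) (rights-inj₂-++ ys l)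

lefts-runs : (xs : List A) (ys : List B) (l : List (A ⊎ B)) →
             lefts (map inj₁ xs ++ map inj₂ ys ++ l) ≡ xs ++ lefts l
lefts-runs xs ys l = trans (lefts-inj₁-++ xs _) (cong (xs ++_) (lefts-inj₂-++ ys l))

rights-runs : (xs : List A) (ys : List B) (l : List (A ⊎ B)) →
              rights (map inj₁ xs ++ map inj₂ ys ++ l) ≡ ys ++ rights l
rights-runs xs ys l = trans (rights-inj₁-++ xs _) (rights-inj₂-++ ys l)

lefts-three-runs : (xs : List A) (ys : List B) (zs : List A) →
                   lefts (map inj₁ xs ++ map inj₂ ys ++ map inj₁ zs) ≡ xs ++ zs
lefts-three-runs xs ys zs = trans (lefts-runs xs ys _) (cong (xs ++_) (mapMaybeIsInj₁∘mapInj₁ zs))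

rights-three-runs : (xs : List A) (ys : List B) (zs : List A) →
                    rights (map inj₁ xs ++ map inj₂ ys ++ map inj₁ zs) ≡ ys
rights-three-runs xs ys zs =
  trans (rights-runs xs ys _) (trans (cong (ys ++_) (mapMaybeIsInj₂∘mapInj₁ zs)) (++-identityʳ ys))

∈-lefts⁺ : {a : A} {l : List (A ⊎ B)} → inj₁ a ∈ l → a ∈ lefts l
∈-lefts⁺ {l = inj₁ _ ∷ l} (here refl) = here refl
∈-lefts⁺ {l = inj₁ _ ∷ l} (there a∈)  = there (∈-lefts⁺ a∈)
∈-lefts⁺ {l = inj₂ _ ∷ l} (there a∈)  = ∈-lefts⁺ a∈

∈-lefts⁻ : {a : A} {l : List (A ⊎ B)} → a ∈ lefts l → inj₁ a ∈ l
∈-lefts⁻ {l = inj₁ _ ∷ l} (here refl) = here refl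
∈-lefts⁻ {l = inj₁ _ ∷ l} (there a∈)  = there (∈-lefts⁻ a∈)
∈-lefts⁻ {l = inj₂ _ ∷ l} a∈          = there (∈-lefts⁻ a∈)

∈-rights⁺ : {b : B} {l : List (A ⊎ B)} → inj₂ b ∈ l → b ∈ rights l
∈-rights⁺ {l = inj₂ _ ∷ l} (here refl) = here refl
∈-rights⁺ {l = inj₂ _ ∷ l} (there b∈)  = there (∈-rights⁺ b∈)
∈-rights⁺ {l = inj₁ _ ∷ l} (there b∈)  = ∈-rights⁺ b∈

∈-rights⁻ : {b : B} {l : List (A ⊎ B)} → b ∈ rights l → inj₂ b ∈ l
∈-rights⁻ {l = inj₂ _ ∷ l} (here refl) = here refl
∈-rights⁻ {l = inj₂ _ ∷ l} (there b∈)  = there (∈-rights⁻ b∈)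
∈-rights⁻ {l = inj₁ _ ∷ l} b∈          = there (∈-rights⁻ b∈)

Unique-lefts : {l : List (A ⊎ B)} → Unique l → Unique (lefts l)
Unique-lefts {l = []}         []       = []
Unique-lefts {l = inj₁ a ∷ l} (a∉ ∷ u) =
  All.tabulate (λ b∈ a≡b → All.lookup a∉ (∈-lefts⁻ b∈) (cong inj₁ a≡b)) ∷ Unique-lefts u
Unique-lefts {l = inj₂ b ∷ l} (_ ∷ u)  = Unique-lefts u

Unique-rights : {l : List (A ⊎ B)} → Unique l → Unique (rights l)
Unique-rights {l = []}         []       = []
Unique-rights {l = inj₂ b ∷ l} (b∉ ∷ u) =
  All.tabulate (λ c∈ b≡c → All.lookup b∉ (∈-rights⁻ c∈) (cong inj₂ b≡c)) ∷ Unique-rights u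
Unique-rights {l = inj₁ a ∷ l} (_ ∷ u)  = Unique-rights u

Unique-lefts-rights : {l : List (A ⊎ B)} → Unique (lefts l) → Unique (rights l) → Unique l
Unique-lefts-rights {l = []}         _          _          = []
Unique-lefts-rights {l = inj₁ a ∷ l} (a∉ ∷ ul) ur        =
  All.tabulate (λ { w∈ refl → All.lookup a∉ (∈-lefts⁺ w∈) refl }) ∷ Unique-lefts-rights ul ur
Unique-lefts-rights {l = inj₂ b ∷ l} ul        (b∉ ∷ ur) =
  All.tabulate (λ { w∈ refl → All.lookup b∉ (∈-rights⁺ w∈) refl }) ∷ Unique-lefts-rights ul ur

data LeftRun {A B : Set} : List (A ⊎ B) → Set where
  whole : ∀ a → LeftRun (map inj₁ a)
  split : ∀ a p r → LeftRun (map inj₁ a ++ inj₂ p ∷ r)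

leftRun : (l : List (A ⊎ B)) → LeftRun l
leftRun []           = whole []
leftRun (inj₂ p ∷ r) = split [] p r
leftRun (inj₁ g ∷ r) with leftRun r
... | whole a     = whole (g ∷ a)
... | split a p r′ = split (g ∷ a) p r′

data RightRun {A B : Set} : List (A ⊎ B) → Set where
  whole : ∀ b → RightRun (map inj₂ b)
  split : ∀ b g r → RightRun (map inj₂ b ++ inj₁ g ∷ r)

rightRun : (l : List (A ⊎ B)) → RightRun l
rightRun []           = whole []
rightRun (inj₁ g ∷ r) = split [] g r
rightRun (inj₂ p ∷ r) with rightRun r
... | whole b      = whole (p ∷ b)
... | split b g r′ = split (p ∷ b) g r′

record Enumeration (K : A → Set) (l : List A) : Set where
  field
    unique   : Unique l
    complete : ∀ {a} → K a → a ∈ l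
    sound    : ∀ {a} → a ∈ l → K a

open Enumeration

module _ {K K′ : A → Set} where

  Enumeration-resp : (∀ {a} → K a → K′ a) → (∀ {a} → K′ a → K a) →
                     ∀ {l} → Enumeration K l → Enumeration K′ l
  Enumeration-resp to from e = record
    { unique = unique e ; complete = complete e ∘ from ; sound = to ∘ sound e }

module _ {K : A → Set} {L : B → Set} {l : List (A ⊎ B)} where

  Enumeration-⊎⁻ : Enumeration (K ⟨⊎⟩ L) l → Enumeration K (lefts l) × Enumeration L (rights l)
  Enumeration-⊎⁻ e =
    record { unique   = Unique-lefts (unique e)
           ; complete = ∈-lefts⁺ ∘ complete e
           ; sound    = sound e ∘ ∈-lefts⁻ } ,
    record { unique   = Unique-rights (unique e)
           ; complete = ∈-rights⁺ ∘ complete e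
           ; sound    = sound e ∘ ∈-rights⁻ }

  Enumeration-⊎⁺ : Enumeration K (lefts l) → Enumeration L (rights l) → Enumeration (K ⟨⊎⟩ L) l
  Enumeration-⊎⁺ eK eL = record
    { unique   = Unique-lefts-rights (unique eK) (unique eL)
    ; complete = λ { {inj₁ a} ka → ∈-lefts⁻ (complete eK ka) ; {inj₂ b} lb → ∈-rights⁻ (complete eL lb) }
    ; sound    = λ { {inj₁ a} a∈ → sound eK (∈-lefts⁺ a∈) ; {inj₂ b} b∈ → sound eL (∈-rights⁺ b∈) }
    }

module _ (_≟_ : DecidableEquality A) where

  Enumeration-insert : ∀ (xs : List A) {ys z} → Enumeration (_≢ z) (xs ++ ys) → Enumeration U (xs ++ z ∷ ys)
  Enumeration-insert xs {z = z} e = record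
    { unique   = Unique-insert xs (unique e) (λ z∈ → sound e z∈ refl)
    ; complete = complete′
    ; sound    = λ _ → tt
    }
    where
    complete′ : ∀ {a} → U a → a ∈ xs ++ z ∷ _
    complete′ {a} _ with a ≟ z
    ... | yes refl = ∈-insert xs
    ... | no a≢z   = ∈-++-insert xs (complete e a≢z)

Enumeration-delete : ∀ (xs : List A) {ys z} → Enumeration U (xs ++ z ∷ ys) → Enumeration (_≢ z) (xs ++ ys)
Enumeration-delete xs e = record
  { unique   = Unique-delete xs (unique e)
  ; complete = λ a≢z → ∈-++-delete xs (complete e tt) a≢z
  ; sound    = ∉-++-middle xs (unique e)
  }

module _ (_≟_ : DecidableEquality A) where

  Enumeration-replace : ∀ (xs : List A) {ys z w} →
                        Enumeration (_≢ z) (xs ++ w ∷ ys) → Enumeration (_≢ w) (xs ++ z ∷ ys)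
  Enumeration-replace xs {ys} {z} {w} e =
    subst (Enumeration (_≢ w)) (++-assoc xs [ z ] ys)
      (Enumeration-delete (xs ++ [ z ])
        (subst (Enumeration U) (sym (++-assoc xs [ z ] (w ∷ ys))) (Enumeration-insert _≟_ xs e)))

record IsHamPathOn (K : A → Set) (R : A → A → Set) (s t : A) (l : List A) : Set where
  field
    enumeration : Enumeration K l
    linked      : Linked R l
    head≡       : head l ≡ just s
    last≡       : last l ≡ just t

open IsHamPathOn

IsHamPathOn-resp : {K K′ : A → Set} {R : A → A → Set} → (∀ {a} → K a → K′ a) → (∀ {a} → K′ a → K a) →
                   ∀ {s t l} → IsHamPathOn K R s t l → IsHamPathOn K′ R s t l
IsHamPathOn-resp to from h = record
  { enumeration = Enumeration-resp to from (enumeration h)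
  ; linked = linked h ; head≡ = head≡ h ; last≡ = last≡ h }

IsHamPathOn-reverse : {K : A → Set} {R : A → A → Set} → (∀ {a b} → R a b → R b a) →
                      ∀ {s t l} → IsHamPathOn K R s t l → IsHamPathOn K R t s (reverse l)
IsHamPathOn-reverse {A = A} R-sym {l = l} h = record
  { enumeration = record
    { unique   = Unique-resp-↭ (↭-sym (↭-reverse l)) (unique (enumeration h))
    ; complete = Any.reverse⁺ ∘ complete (enumeration h)
    ; sound    = sound (enumeration h) ∘ Any.reverse⁻
    }
  ; linked = Linked-reverse R-sym (linked h)
  ; head≡  = trans (head-reverse l) (last≡ h)
  ; last≡  = trans (last-reverse l) (head≡ h)
  }
  where
  open Permutation (setoid A) using (↭-sym)
  open PermutationProperties (setoid A) using (↭-reverse; Unique-resp-↭)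

IsHamPathOn-reverse-unique : {K : A → Set} {R : A → A → Set} → (∀ {a b} → R a b → R b a) →
  ∀ {s t l} → (∀ q → IsHamPathOn K R s t q → q ≡ l) → ∀ q → IsHamPathOn K R t s q → q ≡ reverse l
IsHamPathOn-reverse-unique R-sym l-unique q q-path =
  trans (sym (reverse-involutive q)) (cong reverse (l-unique (reverse q) (IsHamPathOn-reverse R-sym q-path)))

fromIsHamPath : (H : Graph) {s t : V H} {p : List (V H)} → IsHamPath H s t p → IsHamPathOn U (E H) s t p
fromIsHamPath H (u , all , lk , hd , lt) = record
  { enumeration = record { unique = u ; complete = λ {a} _ → all a ; sound = λ _ → tt }
  ; linked = lk ; head≡ = hd ; last≡ = lt }

toIsHamPath : (H : Graph) {s t : V H} {p : List (V H)} → IsHamPathOn U (E H) s t p → IsHamPath H s t p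
toIsHamPath H h = unique (enumeration h) , (λ a → complete (enumeration h) tt) , linked h , head≡ h , last≡ h

module Restriction {A : Set} (k : A → Bool) (R : A → A → Set) where

  -- IsHamPath unfolds to this for any graph with vertices Sub k and adjacency R on first
  -- components, such as G -ᵛ w and splice.
  IsSubHamPath : Sub k → Sub k → List (Sub k) → Set
  IsSubHamPath s₀ t₀ q =
    Unique q × (∀ u → u ∈ q) × Linked (λ a b → R (proj₁ a) (proj₁ b)) q
    × head q ≡ just s₀ × last q ≡ just t₀

  proj₁-injective : {a b : Sub k} → proj₁ a ≡ proj₁ b → a ≡ b
  proj₁-injective {a , p} {.a , q} refl = cong (a ,_) (T-irrel (k a) p q)

  lower : ∀ {s₀ t₀ q} → IsSubHamPath s₀ t₀ q →
          IsHamPathOn (T ∘ k) R (proj₁ s₀) (proj₁ t₀) (map proj₁ q)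
  lower {q = q} (u , all , lk , hd , lt) = record
    { enumeration = record
      { unique   = Unique.map⁺ proj₁-injective u
      ; complete = λ {a} ka → ∈-map⁺ proj₁ (all (a , ka))
      ; sound    = sound′
      }
    ; linked = Linked.map⁺ lk
    ; head≡  = trans (head-map {f = proj₁} q) (cong (Maybe.map proj₁) hd)
    ; last≡  = trans (last-map proj₁ q) (cong (Maybe.map proj₁) lt)
    }
    where
    sound′ : ∀ {a} → a ∈ map proj₁ q → T (k a)
    sound′ a∈ with ∈-map⁻ proj₁ a∈
    ... | w , _ , refl = proj₂ w

  private
    lift-list : (l : List A) → (∀ {a} → a ∈ l → T (k a)) → Σ (List (Sub k)) λ q → map proj₁ q ≡ l
    lift-list []      _    = [] , refl
    lift-list (a ∷ l) in-k with lift-list l (in-k ∘ there)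
    ... | q , refl = (a , in-k (here refl)) ∷ q , refl

  lift : ∀ {s t l} → IsHamPathOn (T ∘ k) R s t l → (ks : T (k s)) (kt : T (k t)) →
         Σ (List (Sub k)) λ q → map proj₁ q ≡ l × IsSubHamPath (s , ks) (t , kt) q
  lift {l = l} h ks kt with lift-list l (sound (enumeration h))
  ... | q , refl =
    q , refl ,
    Unique.map⁻ (unique (enumeration h)) , all , Linked.map⁻ (linked h) ,
    Maybe.map-injective proj₁-injective (trans (sym (head-map {f = proj₁} q)) (head≡ h)) ,
    Maybe.map-injective proj₁-injective (trans (sym (last-map proj₁ q)) (last≡ h))
    where
    all : ∀ w → w ∈ q
    all w with ∈-map⁻ proj₁ (complete (enumeration h) (proj₂ w))
    ... | w′ , w′∈ , eq = subst (_∈ q) (sym (proj₁-injective eq)) w′∈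

module Avoiding (H : Graph) (w : V H) where

  keep : V H → Bool
  keep u = not ⌊ _≟_ H u w ⌋

  open Restriction keep (E H)

  avoids : ∀ {u} → u ≢ w → T (keep u)
  avoids = fromWitnessFalse

  unique-ham-path : ∀ {a b} → UniqueHamPathAvoiding H w a b →
    ∃[ L ] IsHamPathOn (_≢ w) (E H) a b L × (∀ L′ → IsHamPathOn (_≢ w) (E H) a b L′ → L′ ≡ L)
  unique-ham-path (s₀ , t₀ , refl , refl , q , hq , q-unique) =
    map proj₁ q , IsHamPathOn-resp toWitnessFalse avoids (lower hq) , unique′
    where
    unique′ : ∀ L′ → IsHamPathOn (_≢ w) (E H) (proj₁ s₀) (proj₁ t₀) L′ → L′ ≡ map proj₁ q
    unique′ L′ h with lift (IsHamPathOn-resp avoids toWitnessFalse h) (proj₂ s₀) (proj₂ t₀)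
    ... | q′ , refl , hq′ = cong (map proj₁) (q-unique q′ hq′)

  has-ham-path : ∀ {a b L} → IsHamPathOn (_≢ w) (E H) a b L → HasHamPathAvoiding H w a b
  has-ham-path {L = L} h
    with lift (IsHamPathOn-resp avoids toWitnessFalse h)
              (avoids (sound (enumeration h) (head-∈ L (head≡ h))))
              (avoids (sound (enumeration h) (last-∈ L (last≡ h))))
  ... | q , _ , hq = _ , _ , refl , refl , q , hq

NoHamPathBetween : (P : Graph) → V P → V P → Set
NoHamPathBetween P a b = (∀ Q → ¬ IsHamPathOn U (E P) a b Q) × (∀ Q → ¬ IsHamPathOn U (E P) b a Q)

-- Conditions (i)–(iv); (iii) is stated in both directions so that it survives exchanging σ₁ and σ₂.
SpliceCondition : (G : Graph) (x y s t : V G) (P : Graph) (σ₁ σ₂ : V P) → Set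
SpliceCondition G x y s t P σ₁ σ₂ =
  (y ≢ s × y ≢ t × (∀ L → ¬ IsHamPathOn (_≢ y) (E G) s t L))
  ⊎ (∃[ z ] (E G x z × E G y z))
  ⊎ NoHamPathBetween P σ₁ σ₂
  ⊎ (y ≡ s ⊎ y ≡ t)

-- (u₁, σ₁) and (u₂, σ₂) are the pairs (x₁, s′) and (x₂, t′), ordered so that P_H visits u₁, x, u₂.
module OrientedSplice
  (G : Graph) (x y x₁ x₂ : V G) (P : Graph) (s' t' v : V P)
  (u₁ u₂ : V G) (σ₁ σ₂ : V P)
  (cross⁻ : ∀ {g p} → Cross G x y x₁ x₂ P s' t' v g p →
            (g ≡ y × E P v p) ⊎ (g ≡ u₁ × p ≡ σ₁) ⊎ (g ≡ u₂ × p ≡ σ₂))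
  (cross₁ : Cross G x y x₁ x₂ P s' t' v u₁ σ₁)
  (cross₂ : Cross G x y x₁ x₂ P s' t' v u₂ σ₂)
  (deg : Degree3With G x y u₁ u₂)
  where

  W : Set
  W = V G ⊎ V P

  _~_ : W → W → Set
  _~_ = SE G x y x₁ x₂ P s' t' v

  Keep : W → Set
  Keep = (_≢ x) ⟨⊎⟩ (_≢ v)

  Port : V G → Set
  Port g = g ≡ y ⊎ g ≡ u₁ ⊎ g ≡ u₂

  x~y : E G x y
  x~y = let (e , _) = deg in e

  y≢u₁ : y ≢ u₁
  y≢u₁ = let (_ , _ , _ , n , _) = deg in n

  y≢u₂ : y ≢ u₂
  y≢u₂ = let (_ , _ , _ , _ , n , _) = deg in n

  u₁≢u₂ : u₁ ≢ u₂
  u₁≢u₂ = let (_ , _ , _ , _ , _ , n , _) = deg in n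

  neighbour-port : ∀ {g} → E G x g → Port g
  neighbour-port = let (_ , _ , _ , _ , _ , _ , nb) = deg in nb _

  port-adjacent : ∀ {g} → Port g → E G x g
  port-adjacent (inj₁ refl)        = x~y
  port-adjacent (inj₂ (inj₁ refl)) = let (_ , e , _) = deg in e
  port-adjacent (inj₂ (inj₂ refl)) = let (_ , _ , e , _) = deg in e

  cross-port : ∀ {g p} → inj₁ g ~ inj₂ p → Port g
  cross-port e with cross⁻ e
  ... | inj₁ (g≡y , _)         = inj₁ g≡y
  ... | inj₂ (inj₁ (g≡u₁ , _)) = inj₂ (inj₁ g≡u₁)
  ... | inj₂ (inj₂ (g≡u₂ , _)) = inj₂ (inj₂ g≡u₂)

  cross-adjacent : ∀ {g p} → inj₁ g ~ inj₂ p → E G x g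
  cross-adjacent = port-adjacent ∘′ cross-port

  cross-u₁ : ∀ {p} → inj₁ u₁ ~ inj₂ p → p ≡ σ₁
  cross-u₁ e with cross⁻ e
  ... | inj₁ (u₁≡y , _)         = ⊥-elim (y≢u₁ (sym u₁≡y))
  ... | inj₂ (inj₁ (_ , p≡σ₁))  = p≡σ₁
  ... | inj₂ (inj₂ (u₁≡u₂ , _)) = ⊥-elim (u₁≢u₂ u₁≡u₂)

  cross-u₂ : ∀ {p} → inj₁ u₂ ~ inj₂ p → p ≡ σ₂
  cross-u₂ e with cross⁻ e
  ... | inj₁ (u₂≡y , _)         = ⊥-elim (y≢u₂ (sym u₂≡y))
  ... | inj₂ (inj₁ (u₂≡u₁ , _)) = ⊥-elim (u₁≢u₂ (sym u₂≡u₁))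
  ... | inj₂ (inj₂ (_ , p≡σ₂))  = p≡σ₂

  cross-y : ∀ {p} → inj₁ y ~ inj₂ p → E P v p
  cross-y e with cross⁻ e
  ... | inj₁ (_ , v~p)         = v~p
  ... | inj₂ (inj₁ (y≡u₁ , _)) = ⊥-elim (y≢u₁ y≡u₁)
  ... | inj₂ (inj₂ (y≡u₂ , _)) = ⊥-elim (y≢u₂ y≡u₂)

  two-crossings⇒y : ∀ {g p p′} → inj₁ g ~ inj₂ p → inj₁ g ~ inj₂ p′ → p ≢ p′ → g ≡ y
  two-crossings⇒y e e′ p≢p′ with cross-port e
  ... | inj₁ g≡y         = g≡y
  ... | inj₂ (inj₁ refl) = ⊥-elim (p≢p′ (trans (cross-u₁ e) (sym (cross-u₁ e′))))
  ... | inj₂ (inj₂ refl) = ⊥-elim (p≢p′ (trans (cross-u₂ e) (sym (cross-u₂ e′))))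

  -- Unless the run is a single vertex, its two ends and the ports just before and after it would
  -- be four distinct ports.
  interior-ports⇒y : ∀ {g a g₂ c g₃ L p b p₂ b₂ M} →
    Unique ((g ∷ a) ++ (g₂ ∷ c) ++ g₃ ∷ L) → Unique ((p ∷ b) ++ (p₂ ∷ b₂) ++ M) →
    inj₁ (lastOf g a) ~ inj₂ p → inj₁ g₂ ~ inj₂ (lastOf p b) →
    inj₁ (lastOf g₂ c) ~ inj₂ p₂ → inj₁ g₃ ~ inj₂ (lastOf p₂ b₂) →
    c ≡ [] × g₂ ≡ y
  interior-ports⇒y {g} {a} {g₂} {c} {g₃} {p = p} {b} {p₂} ul ur la~p g₂~pb lc~p₂ g₃~pb₂ =
    singleton (_≟_ G g₂ (lastOf g₂ c))
    where
    la≢ : ∀ {w} → w ∈ (g₂ ∷ c) ++ g₃ ∷ _ → lastOf g a ≢ w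
    la≢ = Unique-++-disjoint (g ∷ a) ul (lastOf-∈ g a)

    ≢g₃ : ∀ {w} → w ∈ g₂ ∷ c → w ≢ g₃
    ≢g₃ w∈ = Unique-++-disjoint (g₂ ∷ c) (Unique-++⁻ʳ (g ∷ a) ul) w∈ (here refl)

    singleton : Dec (g₂ ≡ lastOf g₂ c) → c ≡ [] × g₂ ≡ y
    singleton (no g₂≢lc) =
      ⊥-elim (four-in-three (cross-port la~p) (cross-port g₂~pb) (cross-port lc~p₂) (cross-port g₃~pb₂)
                (la≢ (here refl)) (la≢ (∈-++⁺ˡ (lastOf-∈ g₂ c))) (la≢ (∈-++⁺ʳ (g₂ ∷ c) (here refl)))
                g₂≢lc (≢g₃ (here refl)) (≢g₃ (lastOf-∈ g₂ c)))
    singleton (yes g₂≡lc) =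
      Unique-lastOf c (Unique-++⁻ˡ (g₂ ∷ c) (Unique-++⁻ʳ (g ∷ a) ul)) (sym g₂≡lc) ,
      two-crossings⇒y g₂~pb (subst (λ w → inj₁ w ~ inj₂ p₂) (sym g₂≡lc) lc~p₂)
        (Unique-++-disjoint (p ∷ b) ur (lastOf-∈ p b) (here refl))

  interior-run⇒y : ∀ g a p b g₂ c p₂ b₂ g₃ r →
    let q = map inj₁ (g ∷ a) ++ map inj₂ (p ∷ b) ++ map inj₁ (g₂ ∷ c) ++ map inj₂ (p₂ ∷ b₂) ++ inj₁ g₃ ∷ r
    in Unique q → Linked _~_ q → c ≡ [] × g₂ ≡ y
  interior-run⇒y g a p b g₂ c p₂ b₂ g₃ r uq lk =
    interior-ports⇒y {L = lefts r} {p₂ = p₂} {b₂} {rights r}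
      (subst Unique lefts≡ (Unique-lefts uq)) (subst Unique rights≡ (Unique-rights uq))
      (Linked-run-exit inj₁ lk) (Linked-run-exit inj₂ rest₁)
      (Linked-run-exit inj₁ (Linked-run-rest inj₂ rest₁)) (Linked-run-exit inj₂ rest₂)
    where
    q₁ : List W
    q₁ = map inj₁ (g₂ ∷ c) ++ map inj₂ (p₂ ∷ b₂) ++ inj₁ g₃ ∷ r

    lefts≡ : lefts (map inj₁ (g ∷ a) ++ map inj₂ (p ∷ b) ++ q₁) ≡ (g ∷ a) ++ (g₂ ∷ c) ++ g₃ ∷ lefts r
    lefts≡ = trans (lefts-runs (g ∷ a) (p ∷ b) _) (cong ((g ∷ a) ++_) (lefts-runs (g₂ ∷ c) (p₂ ∷ b₂) _))

    rights≡ : rights (map inj₁ (g ∷ a) ++ map inj₂ (p ∷ b) ++ q₁) ≡ (p ∷ b) ++ (p₂ ∷ b₂) ++ rights r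
    rights≡ = trans (rights-runs (g ∷ a) (p ∷ b) _) (cong ((p ∷ b) ++_) (rights-runs (g₂ ∷ c) (p₂ ∷ b₂) _))

    rest₁ : Linked _~_ (map inj₂ (p ∷ b) ++ q₁)
    rest₁ = Linked-run-rest inj₁ lk

    rest₂ : Linked _~_ (map inj₂ (p₂ ∷ b₂) ++ inj₁ g₃ ∷ r)
    rest₂ = Linked-run-rest inj₁ (Linked-run-rest inj₂ rest₁)

  module Canonical (s t : V G) (a₀ : V G) (as : List (V G)) (b₀ : V G) (bs : List (V G))
    (a-end : lastOf a₀ as ≡ u₁) (b-start : b₀ ≡ u₂)
    (pH-path : IsHamPathOn U (E G) s t ((a₀ ∷ as) ++ x ∷ b₀ ∷ bs))
    (pH-unique : ∀ q → IsHamPathOn U (E G) s t q → q ≡ (a₀ ∷ as) ++ x ∷ b₀ ∷ bs)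
    (p₀ : V P) (ps : List (V P))
    (plug-path : IsHamPathOn (_≢ v) (E P) σ₁ σ₂ (p₀ ∷ ps))
    (plug-unique : ∀ Q → IsHamPathOn (_≢ v) (E P) σ₁ σ₂ Q → Q ≡ p₀ ∷ ps)
    where

    pH : List (V G)
    pH = (a₀ ∷ as) ++ x ∷ b₀ ∷ bs

    IsOPath : List W → Set
    IsOPath = IsHamPathOn Keep _~_ (inj₁ s) (inj₁ t)

    L₀ : List W
    L₀ = map inj₁ (a₀ ∷ as) ++ map inj₂ (p₀ ∷ ps) ++ map inj₁ (b₀ ∷ bs)

    a₀≡s : a₀ ≡ s
    a₀≡s = Maybe.just-injective (head≡ pH-path)

    lastOf-b≡t : lastOf b₀ bs ≡ t
    lastOf-b≡t = Maybe.just-injective (trans (sym (last-++-∷ (a₀ ∷ as) x (b₀ ∷ bs))) (last≡ pH-path))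

    x∉a : x ∉ a₀ ∷ as
    x∉a x∈ = Unique-++-disjoint (a₀ ∷ as) (unique (enumeration pH-path)) x∈ (here refl) refl

    p₀≡σ₁ : p₀ ≡ σ₁
    p₀≡σ₁ = Maybe.just-injective (head≡ plug-path)

    lastOf-p≡σ₂ : lastOf p₀ ps ≡ σ₂
    lastOf-p≡σ₂ = Maybe.just-injective (trans (sym (last-∷ p₀ ps)) (last≡ plug-path))

    L₀-path : IsOPath L₀
    L₀-path = record
      { enumeration = Enumeration-⊎⁺
          (subst (Enumeration (_≢ x)) (sym (lefts-three-runs (a₀ ∷ as) (p₀ ∷ ps) (b₀ ∷ bs)))
                 (Enumeration-delete (a₀ ∷ as) (enumeration pH-path)))
          (subst (Enumeration (_≢ v)) (sym (rights-three-runs (a₀ ∷ as) (p₀ ∷ ps) (b₀ ∷ bs)))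
                 (enumeration plug-path))
      ; linked = Linked-map-join inj₁ (Linked-++⁻ˡ (a₀ ∷ as) (linked pH-path))
                   (subst₂ (λ g p → inj₁ g ~ inj₂ p) (sym a-end) (sym p₀≡σ₁) cross₁)
                   (Linked-map-join inj₂ (linked plug-path)
                     (subst₂ (λ g p → inj₁ g ~ inj₂ p) (sym b-start) (sym lastOf-p≡σ₂) cross₂)
                     (Linked.map⁺ (Linked.tail (Linked-++⁻ʳ (a₀ ∷ as) (linked pH-path)))))
      ; head≡ = cong (just ∘′ inj₁) a₀≡s
      ; last≡ = trans (last-++ʳ (map inj₁ (a₀ ∷ as))) (trans (last-++ʳ (map inj₂ (p₀ ∷ ps)))
                  (trans (last-map-∷ inj₁ b₀ bs) (cong (just ∘′ inj₁) lastOf-b≡t)))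
      }

    L₀-keeps-edges : ∀ a b → a ≢ x → b ≢ x → EdgeIn a b pH → EdgeIn (inj₁ a) (inj₁ b) L₀
    L₀-keeps-edges a b a≢x b≢x e with EdgeIn-++-∷⁻ (a₀ ∷ as) a≢x b≢x e
    ... | inj₁ e′ = EdgeIn-++⁺ˡ _ (EdgeIn-map⁺ inj₁ e′)
    ... | inj₂ e′ = EdgeIn-++⁺ʳ (map inj₁ (a₀ ∷ as)) (EdgeIn-++⁺ʳ (map inj₂ (p₀ ∷ ps)) (EdgeIn-map⁺ inj₁ e′))

    O-lefts : ∀ {q} → IsOPath q → Enumeration (_≢ x) (lefts q)
    O-lefts h = proj₁ (Enumeration-⊎⁻ (enumeration h))

    O-rights : ∀ {q} → IsOPath q → Enumeration (_≢ v) (rights q)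
    O-rights h = proj₂ (Enumeration-⊎⁻ (enumeration h))

    O-head : ∀ {g r} → IsOPath (inj₁ g ∷ r) → g ≡ s
    O-head h = Sum.inj₁-injective (Maybe.just-injective (head≡ h))

    O-last : ∀ {q w} → IsOPath q → last q ≡ just w → w ≡ inj₁ t
    O-last h eq = Maybe.just-injective (trans (sym eq) (last≡ h))

    module OneRun (g : V G) (a : List (V G)) (p : V P) (b : List (V P)) (g₂ : V G) (c : List (V G))
                  (h : IsOPath (map inj₁ (g ∷ a) ++ map inj₂ (p ∷ b) ++ map inj₁ (g₂ ∷ c))) where

      lastOf-c≡t : lastOf g₂ c ≡ t
      lastOf-c≡t = Sum.inj₁-injective (O-last h
        (trans (last-++ʳ (map inj₁ (g ∷ a))) (trans (last-++ʳ (map inj₂ (p ∷ b))) (last-map-∷ inj₁ g₂ c))))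

      G-path : IsHamPathOn U (E G) s t ((g ∷ a) ++ x ∷ g₂ ∷ c)
      G-path = record
        { enumeration = Enumeration-insert (_≟_ G) (g ∷ a)
            (subst (Enumeration (_≢ x)) (lefts-three-runs (g ∷ a) (p ∷ b) (g₂ ∷ c)) (O-lefts h))
        ; linked = Linked-join (Linked-run⁻ inj₁ (linked h))
                     (E-sym G (cross-adjacent (Linked-run-exit inj₁ (linked h))))
                     (cross-adjacent (Linked-run-exit inj₂ rest) ∷ Linked.map⁻ (Linked-run-rest inj₂ rest))
        ; head≡ = cong just (O-head h)
        ; last≡ = trans (last-++-∷ (g ∷ a) x (g₂ ∷ c)) (cong just lastOf-c≡t)
        }
        where
        rest : Linked _~_ (map inj₂ (p ∷ b) ++ map inj₁ (g₂ ∷ c))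
        rest = Linked-run-rest inj₁ (linked h)

      x∉ : x ∉ g ∷ a
      x∉ x∈ = sound (O-lefts h) (∈-lefts⁺ (∈-++⁺ˡ (∈-map⁺ inj₁ x∈))) refl

    module AlongPH (p : V P) (b : List (V P))
                      (h : IsOPath (map inj₁ (a₀ ∷ as) ++ map inj₂ (p ∷ b) ++ map inj₁ (b₀ ∷ bs))) where

      P-path : IsHamPathOn (_≢ v) (E P) σ₁ σ₂ (p ∷ b)
      P-path = record
        { enumeration = subst (Enumeration (_≢ v)) (rights-three-runs (a₀ ∷ as) (p ∷ b) (b₀ ∷ bs)) (O-rights h)
        ; linked = Linked-run⁻ inj₂ rest
        ; head≡ = cong just (cross-u₁ (subst (λ g → inj₁ g ~ inj₂ p) a-end (Linked-run-exit inj₁ (linked h))))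
        ; last≡ = trans (last-∷ p b)
                    (cong just (cross-u₂ (subst (λ g → inj₁ g ~ inj₂ (lastOf p b)) b-start (Linked-run-exit inj₂ rest))))
        }
        where
        rest : Linked _~_ (map inj₂ (p ∷ b) ++ map inj₁ (b₀ ∷ bs))
        rest = Linked-run-rest inj₁ (linked h)

    one-run-is-L₀ : ∀ g a p b g₂ c → IsOPath (map inj₁ (g ∷ a) ++ map inj₂ (p ∷ b) ++ map inj₁ (g₂ ∷ c)) →
                    map inj₁ (g ∷ a) ++ map inj₂ (p ∷ b) ++ map inj₁ (g₂ ∷ c) ≡ L₀
    one-run-is-L₀ g a p b g₂ c h
      with ++-cancel-middle (g ∷ a) (g₂ ∷ c) (a₀ ∷ as) (b₀ ∷ bs) (OneRun.x∉ g a p b g₂ c h) x∉a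
             (pH-unique _ (OneRun.G-path g a p b g₂ c h))
    ... | refl , refl = cong (λ Q → map inj₁ (a₀ ∷ as) ++ map inj₂ Q ++ map inj₁ (b₀ ∷ bs))
                             (plug-unique (p ∷ b) (AlongPH.P-path p b h))

    module TwoRuns (g : V G) (a : List (V G)) (p : V P) (b : List (V P))
                   (p₂ : V P) (b₂ : List (V P)) (g₃ : V G) (d : List (V G))
                   (h : IsOPath (map inj₁ (g ∷ a) ++ map inj₂ (p ∷ b) ++ inj₁ y ∷
                                 map inj₂ (p₂ ∷ b₂) ++ map inj₁ (g₃ ∷ d))) where

      la : V G
      la = lastOf g a

      G-enumeration : Enumeration (_≢ x) ((g ∷ a) ++ y ∷ g₃ ∷ d)
      G-enumeration = subst (Enumeration (_≢ x))
        (trans (lefts-runs (g ∷ a) (p ∷ b) _)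
               (cong (λ l → (g ∷ a) ++ y ∷ l) (lefts-three-runs [] (p₂ ∷ b₂) (g₃ ∷ d))))
        (O-lefts h)

      P-enumeration : Enumeration (_≢ v) ((p ∷ b) ++ p₂ ∷ b₂)
      P-enumeration = subst (Enumeration (_≢ v))
        (trans (rights-runs (g ∷ a) (p ∷ b) _) (cong ((p ∷ b) ++_) (rights-three-runs [] (p₂ ∷ b₂) (g₃ ∷ d))))
        (O-rights h)

      rest₁ : Linked _~_ (map inj₂ (p ∷ b) ++ inj₁ y ∷ map inj₂ (p₂ ∷ b₂) ++ map inj₁ (g₃ ∷ d))
      rest₁ = Linked-run-rest inj₁ (linked h)

      rest₂ : Linked _~_ (map inj₂ (p₂ ∷ b₂) ++ map inj₁ (g₃ ∷ d))
      rest₂ = Linked.tail (Linked-run-rest inj₂ rest₁)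

      la~p : inj₁ la ~ inj₂ p
      la~p = Linked-run-exit inj₁ (linked h)

      y~pb : inj₁ y ~ inj₂ (lastOf p b)
      y~pb = Linked-run-exit inj₂ rest₁

      y~p₂ : inj₁ y ~ inj₂ p₂
      y~p₂ = Linked.head (Linked-run-rest inj₂ rest₁)

      g₃~pb₂ : inj₁ g₃ ~ inj₂ (lastOf p₂ b₂)
      g₃~pb₂ = Linked-run-exit inj₂ rest₂

      lkD : Linked (E G) (g₃ ∷ d)
      lkD = Linked.map⁻ (Linked-run-rest inj₂ rest₂)

      lkQ₁ : Linked (E P) (p ∷ b)
      lkQ₁ = Linked-run⁻ inj₂ rest₁

      lkQ₂ : Linked (E P) (p₂ ∷ b₂)
      lkQ₂ = Linked-run⁻ inj₂ rest₂

      g≡s : g ≡ s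
      g≡s = O-head h

      lastOf-d≡t : lastOf g₃ d ≡ t
      lastOf-d≡t = Sum.inj₁-injective (O-last h
        (trans (last-++ʳ (map inj₁ (g ∷ a))) (trans (last-++ʳ (map inj₂ (p ∷ b)))
          (trans (last-++ʳ (map inj₂ (p₂ ∷ b₂))) (last-map-∷ inj₁ g₃ d)))))

      private
        A≢rest : ∀ {u w} → u ∈ g ∷ a → w ∈ y ∷ g₃ ∷ d → u ≢ w
        A≢rest = Unique-++-disjoint (g ∷ a) (unique G-enumeration)

        y≢D : ∀ {w} → w ∈ g₃ ∷ d → y ≢ w
        y≢D = Unique-++-disjoint [ y ] (Unique-++⁻ʳ (g ∷ a) (unique G-enumeration)) (here refl)

      y≢s : y ≢ s
      y≢s y≡s = A≢rest (here refl) (here refl) (trans g≡s (sym y≡s))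

      y≢t : y ≢ t
      y≢t y≡t = y≢D (lastOf-∈ g₃ d) (trans y≡t (sym lastOf-d≡t))

      outer-ports : (la ≡ u₁ × g₃ ≡ u₂) ⊎ (la ≡ u₂ × g₃ ≡ u₁)
      outer-ports = two-in-two (drop-first (cross-port la~p) (λ y≡la → A≢rest (lastOf-∈ g a) (here refl) (sym y≡la)))
                               (drop-first (cross-port g₃~pb₂) (y≢D (here refl)))
                               (A≢rest (lastOf-∈ g a) (there (here refl)))

      G-path-via : ∀ {K} m ms → Enumeration K ((g ∷ a) ++ (m ∷ ms) ++ g₃ ∷ d) →
                   E G la m → Linked (E G) ((m ∷ ms) ++ g₃ ∷ d) →
                   IsHamPathOn K (E G) s t ((g ∷ a) ++ (m ∷ ms) ++ g₃ ∷ d)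
      G-path-via m ms e la~m lk = record
        { enumeration = e
        ; linked      = Linked-join (Linked-run⁻ inj₁ (linked h)) la~m lk
        ; head≡       = cong just g≡s
        ; last≡       = trans (last-++ʳ (g ∷ a)) (trans (last-++-∷ (m ∷ ms) g₃ d) (cong just lastOf-d≡t))
        }

      la~x : E G la x
      la~x = E-sym G (cross-adjacent la~p)

      x~g₃ : E G x g₃
      x~g₃ = cross-adjacent g₃~pb₂

      avoiding-path : IsHamPathOn (_≢ y) (E G) s t ((g ∷ a) ++ x ∷ g₃ ∷ d)
      avoiding-path = G-path-via x [] (Enumeration-replace (_≟_ G) (g ∷ a) G-enumeration) la~x (x~g₃ ∷ lkD)

      through-x-y : ¬ EdgeIn x y pH → E G y g₃ → ⊥
      through-x-y xy∉pH y~g₃ = xy∉pH (subst (EdgeIn x y) (pH-unique _ path) (EdgeIn-middle (g ∷ a) x y (g₃ ∷ d)))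
        where
        path : IsHamPathOn U (E G) s t ((g ∷ a) ++ x ∷ y ∷ g₃ ∷ d)
        path = G-path-via x [ y ] (Enumeration-insert (_≟_ G) (g ∷ a) G-enumeration) la~x (x~y ∷ y~g₃ ∷ lkD)

      through-y-x : ¬ EdgeIn x y pH → E G y la → ⊥
      through-y-x xy∉pH y~la =
        xy∉pH (subst (EdgeIn x y) (pH-unique _ path) (EdgeIn-sym (EdgeIn-middle (g ∷ a) y x (g₃ ∷ d))))
        where
        path : IsHamPathOn U (E G) s t ((g ∷ a) ++ y ∷ x ∷ g₃ ∷ d)
        path = G-path-via y [ x ]
                 (subst (Enumeration U) (++-assoc (g ∷ a) [ y ] (x ∷ g₃ ∷ d))
                   (Enumeration-insert (_≟_ G) ((g ∷ a) ++ [ y ])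
                     (subst (Enumeration (_≢ x)) (sym (++-assoc (g ∷ a) [ y ] (g₃ ∷ d))) G-enumeration)))
                 (E-sym G y~la) (E-sym G x~y ∷ x~g₃ ∷ lkD)

      no-triangle : ¬ EdgeIn x y pH → ∀ z → E G x z → E G y z → ⊥
      no-triangle xy∉pH z x~z y~z
        with drop-first (neighbour-port x~z) (λ y≡z → E-irrefl G (subst (E G y) (sym y≡z) y~z)) | outer-ports
      ... | inj₁ z≡u₁ | inj₁ (la≡u₁ , _) = through-y-x xy∉pH (subst (E G y) (trans z≡u₁ (sym la≡u₁)) y~z)
      ... | inj₂ z≡u₂ | inj₂ (la≡u₂ , _) = through-y-x xy∉pH (subst (E G y) (trans z≡u₂ (sym la≡u₂)) y~z)
      ... | inj₁ z≡u₁ | inj₂ (_ , g₃≡u₁) = through-x-y xy∉pH (subst (E G y) (trans z≡u₁ (sym g₃≡u₁)) y~z)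
      ... | inj₂ z≡u₂ | inj₁ (_ , g₃≡u₂) = through-x-y xy∉pH (subst (E G y) (trans z≡u₂ (sym g₃≡u₂)) y~z)

      plug-path-through-v : IsHamPathOn U (E P) p (lastOf p₂ b₂) ((p ∷ b) ++ v ∷ p₂ ∷ b₂)
      plug-path-through-v = record
        { enumeration = Enumeration-insert (_≟_ P) (p ∷ b) P-enumeration
        ; linked      = Linked-join lkQ₁ (E-sym P (cross-y y~pb)) (cross-y y~p₂ ∷ lkQ₂)
        ; head≡       = refl
        ; last≡       = last-++-∷ (p ∷ b) v (p₂ ∷ b₂)
        }

      P-path : IsHamPathOn U (E P) σ₁ σ₂ ((p ∷ b) ++ v ∷ p₂ ∷ b₂) ⊎
               IsHamPathOn U (E P) σ₂ σ₁ ((p ∷ b) ++ v ∷ p₂ ∷ b₂)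
      P-path with outer-ports
      ... | inj₁ (la≡u₁ , g₃≡u₂) =
        inj₁ (subst₂ (λ σ σ′ → IsHamPathOn U (E P) σ σ′ _)
                     (cross-u₁ (subst (λ w → inj₁ w ~ inj₂ p) la≡u₁ la~p))
                     (cross-u₂ (subst (λ w → inj₁ w ~ inj₂ (lastOf p₂ b₂)) g₃≡u₂ g₃~pb₂))
                     plug-path-through-v)
      ... | inj₂ (la≡u₂ , g₃≡u₁) =
        inj₂ (subst₂ (λ σ σ′ → IsHamPathOn U (E P) σ σ′ _)
                     (cross-u₂ (subst (λ w → inj₁ w ~ inj₂ p) la≡u₂ la~p))
                     (cross-u₁ (subst (λ w → inj₁ w ~ inj₂ (lastOf p₂ b₂)) g₃≡u₁ g₃~pb₂))
                     plug-path-through-v)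

      impossible : SpliceCondition G x y s t P σ₁ σ₂ → ¬ EdgeIn x y pH → ⊥
      impossible (inj₁ (_ , _ , no-G-path))               _     = no-G-path _ avoiding-path
      impossible (inj₂ (inj₁ (z , x~z , y~z)))            xy∉pH = no-triangle xy∉pH z x~z y~z
      impossible (inj₂ (inj₂ (inj₁ (no-P₁₂ , no-P₂₁))))   _     = [ no-P₁₂ _ , no-P₂₁ _ ]′ P-path
      impossible (inj₂ (inj₂ (inj₂ (inj₁ y≡s))))          _     = y≢s y≡s
      impossible (inj₂ (inj₂ (inj₂ (inj₂ y≡t))))          _     = y≢t y≡t

    σ₁≢v : σ₁ ≢ v
    σ₁≢v = sound (enumeration plug-path) (head-∈ (p₀ ∷ ps) (head≡ plug-path))

    private
      ends-in-G : ∀ {q} p b → IsOPath q → last q ≡ last (map inj₂ (p ∷ b)) → ⊥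
      ends-in-G p b h eq with O-last h (trans eq (last-map-∷ inj₂ p b))
      ... | ()

    -- A lone G-run misses σ₁, and q cannot end in P. One P-run makes q = L₀;
    -- with two, the middle G-run is [y] and TwoRuns refutes the condition; with three or more,
    -- the next G-run would be [y] as well.
    L₀-unique : SpliceCondition G x y s t P σ₁ σ₂ → ¬ EdgeIn x y pH → ∀ q → IsOPath q → q ≡ L₀
    L₀-unique _ _ [] h with head≡ h
    ... | ()
    L₀-unique _ _ (inj₂ _ ∷ _) h with head≡ h
    ... | ()
    L₀-unique cond xy∉pH (inj₁ g ∷ r) h with leftRun r
    ... | whole a with ∈-map⁻ inj₁ (complete (enumeration h) {inj₂ σ₁} σ₁≢v)
    ...   | _ , _ , ()
    L₀-unique cond xy∉pH (inj₁ g ∷ _) h | split a p r₁ with rightRun r₁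
    ... | whole b = ⊥-elim (ends-in-G p b h (last-++ʳ (map inj₁ (g ∷ a))))
    ... | split b g₂ r₂ with leftRun r₂
    ...   | whole c = one-run-is-L₀ g a p b g₂ c h
    ...   | split c p₂ r₃ with rightRun r₃
    ...     | whole b₂ = ⊥-elim (ends-in-G p₂ b₂ h
                (trans (last-++ʳ (map inj₁ (g ∷ a)))
                  (trans (last-++ʳ (map inj₂ (p ∷ b))) (last-++ʳ (map inj₁ (g₂ ∷ c))))))
    ...     | split b₂ g₃ r₄ with interior-run⇒y g a p b g₂ c p₂ b₂ g₃ r₄ (unique (enumeration h)) (linked h)
    ...       | refl , refl with leftRun r₄
    ...         | whole d = ⊥-elim (TwoRuns.impossible g a p b p₂ b₂ g₃ d h cond xy∉pH)
    ...         | split d p₃ r₅ with rightRun r₅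
    ...           | whole b₃ = ⊥-elim (ends-in-G p₃ b₃ h
                      (trans (last-++ʳ (map inj₁ (g ∷ a))) (trans (last-++ʳ (map inj₂ (p ∷ b)))
                        (trans (last-++ʳ (map inj₂ (p₂ ∷ b₂))) (last-++ʳ (map inj₁ (g₃ ∷ d)))))))
    ...           | split b₃ g₄ r₆
                    with Unique-++⁻ʳ (map inj₂ (p ∷ b))
                           (Unique-++⁻ʳ (map inj₁ (g ∷ a)) (unique (enumeration h)))
    ...             | y∉ ∷ u′
                      with interior-run⇒y y [] p₂ b₂ g₃ d p₃ b₃ g₄ r₆ (y∉ ∷ u′)
                             (Linked-++⁻ʳ (map inj₂ (p ∷ b)) (Linked-++⁻ʳ (map inj₁ (g ∷ a)) (linked h)))
    ...               | refl , refl = ⊥-elim (All.lookup y∉ (∈-++⁺ʳ (map inj₂ (p₂ ∷ b₂)) (here refl)) refl)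

module SplicePaths (G : Graph) (x y x₁ x₂ : V G) (P : Graph) (s' t' v : V P) where

  O : Graph
  O = splice G x y x₁ x₂ P s' t' v

  Keep : V G ⊎ V P → Set
  Keep = (_≢ x) ⟨⊎⟩ (_≢ v)

  keep⇒T : ∀ w → Keep w → T (spliceKeep G x y x₁ x₂ P s' t' v w)
  keep⇒T (inj₁ _) = fromWitnessFalse
  keep⇒T (inj₂ _) = fromWitnessFalse

  T⇒keep : ∀ w → T (spliceKeep G x y x₁ x₂ P s' t' v w) → Keep w
  T⇒keep (inj₁ _) = toWitnessFalse
  T⇒keep (inj₂ _) = toWitnessFalse

  open Restriction (spliceKeep G x y x₁ x₂ P s' t' v) (SE G x y x₁ x₂ P s' t' v)

  SplicedUniqueHamPath : (s t : V G) (pH : List (V G)) → Set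
  SplicedUniqueHamPath s t pH =
    Σ (V O) λ ŝ → Σ (V O) λ t̂ → proj₁ ŝ ≡ inj₁ s × proj₁ t̂ ≡ inj₁ t
    × Σ (List (V O)) λ pO → IsHamPath O ŝ t̂ pO × (∀ q → IsHamPath O ŝ t̂ q → q ≡ pO)
      × (∀ (a b : V O) (a' b' : V G) → proj₁ a ≡ inj₁ a' → proj₁ b ≡ inj₁ b' → EdgeIn a' b' pH → EdgeIn a b pO)

  lift-unique-path : ∀ {s t pH L₀} → s ≢ x → t ≢ x →
    IsHamPathOn Keep (SE G x y x₁ x₂ P s' t' v) (inj₁ s) (inj₁ t) L₀ →
    (∀ q → IsHamPathOn Keep (SE G x y x₁ x₂ P s' t' v) (inj₁ s) (inj₁ t) q → q ≡ L₀) →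
    (∀ a b → a ≢ x → b ≢ x → EdgeIn a b pH → EdgeIn (inj₁ a) (inj₁ b) L₀) →
    SplicedUniqueHamPath s t pH
  lift-unique-path {s} {t} {pH} s≢x t≢x path L₀-unique keeps-edges
    with lift (IsHamPathOn-resp (λ {w} → keep⇒T w) (λ {w} → T⇒keep w) path)
              (keep⇒T (inj₁ s) s≢x) (keep⇒T (inj₁ t) t≢x)
  ... | pO , refl , pO-path = ŝ , t̂ , refl , refl , pO , pO-path , pO-unique , pO-keeps-edges
    where
    ŝ t̂ : V O
    ŝ = inj₁ s , keep⇒T (inj₁ s) s≢x
    t̂ = inj₁ t , keep⇒T (inj₁ t) t≢x

    pO-unique : ∀ q → IsHamPath O ŝ t̂ q → q ≡ pO
    pO-unique q q-path =
      map-injective proj₁-injective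
        (L₀-unique _ (IsHamPathOn-resp (λ {w} → T⇒keep w) (λ {w} → keep⇒T w) (lower q-path)))

    pO-keeps-edges : ∀ (a b : V O) a′ b′ → proj₁ a ≡ inj₁ a′ → proj₁ b ≡ inj₁ b′ →
                     EdgeIn a′ b′ pH → EdgeIn a b pO
    pO-keeps-edges (_ , ka) (_ , kb) a′ b′ refl refl e =
      EdgeIn-map⁻ proj₁-injective pO (keeps-edges a′ b′ (T⇒keep (inj₁ a′) ka) (T⇒keep (inj₁ b′) kb) e)

Degree3With-swap : ∀ {G : Graph} {x y x₁ x₂} → Degree3With G x y x₁ x₂ → Degree3With G x y x₂ x₁
Degree3With-swap (x~y , x~x₁ , x~x₂ , y≢x₁ , y≢x₂ , x₁≢x₂ , neighbours) =
  x~y , x~x₂ , x~x₁ , y≢x₂ , y≢x₁ , x₁≢x₂ ∘ sym , λ w → ⊎-map id ⊎-swap ∘ neighbours w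

strong⇒no-ham-path-between : ∀ {P : Graph} {s' t' v} → IsStrongHPlugin P s' t' v → NoHamPathBetween P s' t'
strong⇒no-ham-path-between {P} (_ , no-path) =
  (λ Q Q-path → no-path (Q , toIsHamPath P Q-path)) ,
  (λ Q Q-path → no-path (reverse Q , toIsHamPath P (IsHamPathOn-reverse (E-sym P) Q-path)))

splice-condition : ∀ (G : Graph) {x y s t} (P : Graph) {s' t' v σ₁ σ₂} →
  (NoHamPathBetween P s' t' → NoHamPathBetween P σ₁ σ₂) →
  (y ≢ s × y ≢ t × ¬ HasHamPathAvoiding G y s t) ⊎ (∃[ z ] (E G x z × E G y z))
  ⊎ IsStrongHPlugin P s' t' v ⊎ (y ≡ s ⊎ y ≡ t) →
  SpliceCondition G x y s t P σ₁ σ₂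
splice-condition G {y = y} P orient =
  ⊎-map (λ (y≢s , y≢t , no-path) → y≢s , y≢t , λ _ L-path → no-path (Avoiding.has-ham-path G y L-path))
        (⊎-map id (⊎-map (orient ∘ strong⇒no-ham-path-between {P}) id))

neighbours-on-path : ∀ {G : Graph} {s t x y x₁ x₂ a₀ as b₀ bs} →
  IsHamPathOn U (E G) s t ((a₀ ∷ as) ++ x ∷ b₀ ∷ bs) → Degree3With G x y x₁ x₂ →
  ¬ EdgeIn x y ((a₀ ∷ as) ++ x ∷ b₀ ∷ bs) →
  (lastOf a₀ as ≡ x₁ × b₀ ≡ x₂) ⊎ (lastOf a₀ as ≡ x₂ × b₀ ≡ x₁)
neighbours-on-path {G} {x = x} {a₀ = a₀} {as} {b₀} {bs} pH-path (_ , _ , _ , _ , _ , _ , neighbours) xy∉pH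
  =
  two-in-two
    (drop-first (neighbours _ (E-sym G (Linked-boundary a₀ as (linked pH-path))))
      (λ { refl → xy∉pH (EdgeIn-sym (EdgeIn-lastOf a₀ as x (b₀ ∷ bs))) }))
    (drop-first (neighbours _ (Linked.head (Linked-++⁻ʳ (a₀ ∷ as) (linked pH-path))))
      (λ { refl → xy∉pH (EdgeIn-middle (a₀ ∷ as) x b₀ bs) }))
    (Unique-++-disjoint (a₀ ∷ as) (unique (enumeration pH-path)) (lastOf-∈ a₀ as) (there (here refl)))

module Splicing
  (G : Graph) (x y x₁ x₂ : V G) (P : Graph) (s' t' v : V P)
  (s t a₀ : V G) (as : List (V G)) (b₀ : V G) (bs : List (V G))
  (pH-path : IsHamPathOn U (E G) s t ((a₀ ∷ as) ++ x ∷ b₀ ∷ bs))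
  (pH-unique : ∀ q → IsHamPathOn U (E G) s t q → q ≡ (a₀ ∷ as) ++ x ∷ b₀ ∷ bs)
  (s≢x : s ≢ x) (t≢x : t ≢ x) (xy∉pH : ¬ EdgeIn x y ((a₀ ∷ as) ++ x ∷ b₀ ∷ bs))
  where

  open SplicePaths G x y x₁ x₂ P s' t' v

  spliced-unique-path : (u₁ u₂ : V G) (σ₁ σ₂ : V P) →
    (∀ {g p} → Cross G x y x₁ x₂ P s' t' v g p →
               (g ≡ y × E P v p) ⊎ (g ≡ u₁ × p ≡ σ₁) ⊎ (g ≡ u₂ × p ≡ σ₂)) →
    Cross G x y x₁ x₂ P s' t' v u₁ σ₁ → Cross G x y x₁ x₂ P s' t' v u₂ σ₂ →
    Degree3With G x y u₁ u₂ → lastOf a₀ as ≡ u₁ → b₀ ≡ u₂ →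
    (P₀ : List (V P)) → IsHamPathOn (_≢ v) (E P) σ₁ σ₂ P₀ →
    (∀ Q → IsHamPathOn (_≢ v) (E P) σ₁ σ₂ Q → Q ≡ P₀) →
    SpliceCondition G x y s t P σ₁ σ₂ →
    SplicedUniqueHamPath s t ((a₀ ∷ as) ++ x ∷ b₀ ∷ bs)
  spliced-unique-path _ _ _ _ _ _ _ _ _ _ [] P₀-path _ _ with head≡ P₀-path
  ... | ()
  spliced-unique-path u₁ u₂ σ₁ σ₂ cross⁻ cross₁ cross₂ deg a-end b-start (p₀ ∷ ps) P₀-path P₀-unique cond =
    lift-unique-path s≢x t≢x L₀-path (L₀-unique cond xy∉pH) L₀-keeps-edges
    where
    open OrientedSplice.Canonical G x y x₁ x₂ P s' t' v u₁ u₂ σ₁ σ₂ cross⁻ cross₁ cross₂ deg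
           s t a₀ as b₀ bs a-end b-start pH-path pH-unique p₀ ps P₀-path P₀-unique

  -- If P_H meets x₂ before x₁, the plugin path is traversed from t′ to s′.
  spliced : Degree3With G x y x₁ x₂ → IsHPlugin P s' t' v →
    (y ≢ s × y ≢ t × ¬ HasHamPathAvoiding G y s t) ⊎ (∃[ z ] (E G x z × E G y z))
    ⊎ IsStrongHPlugin P s' t' v ⊎ (y ≡ s ⊎ y ≡ t) →
    SplicedUniqueHamPath s t ((a₀ ∷ as) ++ x ∷ b₀ ∷ bs)
  spliced deg plug cond with neighbours-on-path {G} pH-path deg xy∉pH | Avoiding.unique-ham-path P v plug
  ... | inj₁ (a-end , b-start) | P₀ , P₀-path , P₀-unique =
    spliced-unique-path x₁ x₂ s' t' id (inj₂ (inj₁ (refl , refl))) (inj₂ (inj₂ (refl , refl)))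
      deg a-end b-start P₀ P₀-path P₀-unique (splice-condition G P id cond)
  ... | inj₂ (a-end , b-start) | P₀ , P₀-path , P₀-unique =
    spliced-unique-path x₂ x₁ t' s' (⊎-map id ⊎-swap) (inj₂ (inj₂ (refl , refl))) (inj₂ (inj₁ (refl , refl)))
      (Degree3With-swap {G} deg) a-end b-start
      (reverse P₀) (IsHamPathOn-reverse (E-sym P) P₀-path) (IsHamPathOn-reverse-unique (E-sym P) P₀-unique)
      (splice-condition G P swap cond)

unique-ham-path-through-splice : (G : Graph) (s t : V G) (pH : List (V G)) →
  IsHamPathOn U (E G) s t pH → (∀ q → IsHamPathOn U (E G) s t q → q ≡ pH) →
  (x y x₁ x₂ : V G) → x ≢ s → x ≢ t → Degree3With G x y x₁ x₂ → ¬ EdgeIn x y pH →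
  (P : Graph) (s' t' v : V P) → IsHPlugin P s' t' v →
  ((y ≢ s × y ≢ t × ¬ HasHamPathAvoiding G y s t) ⊎ (∃[ z ] (E G x z × E G y z))
   ⊎ IsStrongHPlugin P s' t' v ⊎ (y ≡ s ⊎ y ≡ t)) →
  SplicePaths.SplicedUniqueHamPath G x y x₁ x₂ P s' t' v s t pH
unique-ham-path-through-splice G s t pH pH-path pH-unique x y x₁ x₂ x≢s x≢t deg xy∉pH P s' t' v plug cond
  with split-at-interior (complete (enumeration pH-path) tt) (head≡ pH-path) (last≡ pH-path) x≢s x≢t
... | a₀ , as , b₀ , bs , refl =
  Splicing.spliced G x y x₁ x₂ P s' t' v s t a₀ as b₀ bs pH-path pH-unique (x≢s ∘ sym) (x≢t ∘ sym) xy∉pH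
    deg plug cond

corollary1 : (G : Graph) (s t : V G) (pH : List (V G))
    → IsHamPath G s t pH
    → (∀ q → IsHamPath G s t q → q ≡ pH)
    → (x y x₁ x₂ : V G) → x ≢ s → x ≢ t
    → Degree3With G x y x₁ x₂
    → ¬ EdgeIn x y pH
    → (P : Graph) (s' t' v : V P) → IsHPlugin P s' t' v
    → ((y ≢ s × y ≢ t × ¬ HasHamPathAvoiding G y s t)
       ⊎ (∃[ z ] (E G x z × E G y z))
       ⊎ IsStrongHPlugin P s' t' v
       ⊎ (y ≡ s ⊎ y ≡ t))
    → Σ (V (splice G x y x₁ x₂ P s' t' v)) λ ŝ →
      Σ (V (splice G x y x₁ x₂ P s' t' v)) λ t̂ →
        proj₁ ŝ ≡ inj₁ s × proj₁ t̂ ≡ inj₁ t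
        × Σ (List (V (splice G x y x₁ x₂ P s' t' v))) λ pO →
            IsHamPath (splice G x y x₁ x₂ P s' t' v) ŝ t̂ pO
            × (∀ q → IsHamPath (splice G x y x₁ x₂ P s' t' v) ŝ t̂ q → q ≡ pO)
            × (∀ (a b : V (splice G x y x₁ x₂ P s' t' v)) (a' b' : V G)
                 → proj₁ a ≡ inj₁ a' → proj₁ b ≡ inj₁ b'
                 → EdgeIn a' b' pH → EdgeIn a b pO)
corollary1 G s t pH hp pH-unique x y x₁ x₂ x≢s x≢t deg xy∉pH P s' t' v plug cond =
  unique-ham-path-through-splice G s t pH (fromIsHamPath G hp) (λ q → pH-unique q ∘ toIsHamPath G)
    x y x₁ x₂ x≢s x≢t deg xy∉pH P s' t' v plug cond
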